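{- Let $k\ge 2$. For Caching in Matchings where the offline optimum has $k$ matchings, there is a (deterministic) $6$-competitive online algorithm that uses $3k-3$ matchings.
   Context: Caching in Matchings with resource augmentation (general graphs): on a node set, requests for edges arrive online. The online algorithm maintains a cache which is the union of $m$ matchings (here $m=3k-3$). If a requested edge is in none of its matchings, it must insert it into one of them, evicting from that matching the edges incident to its endpoints; it may also add any edge to any matching at any time (keeping each a matching) and evict freely. Each addition of an edge to a matching costs $1$. The offline optimum $OPT$ solves the same problem with $k$ matchings. An online algorithm $A$ is $c$-competitive if there is a constant $d$ (independent of the sequence) with $\mathrm{cost}(A(\sigma))\le c\cdot\mathrm{cost}(OPT(\sigma))+d$ for every request sequence $\sigma$. -}

module Defs where

open import Data.Nat using (ℕ; zero; suc; _+_; _*_; _∸_; _≤_)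
open import Data.Fin using (Fin; toℕ)
open import Data.Fin.Properties using () renaming (_≟_ to _≟ᶠ_)
open import Data.Maybe using (Maybe; just; nothing)
open import Data.Maybe.Properties using (≡-dec)
open import Data.List using (List; []; _∷_; map; allFin)
open import Data.Nat.ListAction using (sum)
open import Data.List.Relation.Binary.Pointwise using (Pointwise)
open import Data.Product using (Σ; ∃; _×_; _,_)
open import Relation.Nullary using (¬_; yes; no)
open import Relation.Binary.PropositionalEquality using (_≡_; _≢_)
import Data.Nat.Properties as ℕP

-- A matching on Fin n is given by its (symmetric,
-- irreflexive) partial "mate" function: the edge {u,v} belongs to the
-- matching iff  mate u ≡ just v  (equivalently mate v ≡ just u).

record Matching (n : ℕ) : Set where
  field
    mate   : Fin n → Maybe (Fin n)
    mate-sym : ∀ u v → mate u ≡ just v → mate v ≡ just u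
    mate-irr : ∀ u → mate u ≢ just u
open Matching public

emptyMatching : ∀ {n} → Matching n
emptyMatching = record
  { mate = λ _ → nothing
  ; mate-sym = λ _ _ ()
  ; mate-irr = λ _ () }

Config : ℕ → ℕ → Set
Config n m = Fin m → Matching n

emptyConfig : ∀ {n m} → Config n m
emptyConfig _ = emptyMatching

record Request (n : ℕ) : Set where
  constructor req
  field
    src : Fin n
    dst : Fin n
    distinct : src ≢ dst
open Request public

_∈C_ : ∀ {n m} → Request n → Config n m → Set
_∈C_ {m = m} r C = ∃ λ (i : Fin m) → mate (C i) (src r) ≡ just (dst r)

-- Cost of going from one cache to another: the number of edges
-- that have to be added, i.e. for each matching, the number of edges
-- of the new matching that are not in the old one.  (Evictions are free;
-- every change can be realised at exactly this cost.)

-- Contribution of node u: 1 iff the new matching has an edge {u,v}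
-- with u < v that is not in the old matching (counts each edge once).
addedAt : ∀ {n} → Matching n → Matching n → Fin n → ℕ
addedAt old new u with mate new u
... | nothing = 0
... | just v with toℕ u ℕP.<? toℕ v
...   | no _ = 0
...   | yes _ with ≡-dec _≟ᶠ_ (mate old u) (just v)
...     | yes _ = 0
...     | no _ = 1

addedM : ∀ {n} → Matching n → Matching n → ℕ
addedM {n} old new = sum (map (addedAt old new) (allFin n))

changeCost : ∀ {n m} → Config n m → Config n m → ℕ
changeCost {m = m} old new = sum (map (λ i → addedM (old i) (new i)) (allFin m))

-- Deterministic online algorithm with m matchings: the cache after
-- serving a request is a function of the requests seen so far
-- (history, most recent request first).

record OnlineAlg (n m : ℕ) : Set where
  field
    step   : List (Request n) → Config n m
    serves : ∀ (r : Request n) (h : List (Request n)) → r ∈C step (r ∷ h)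
open OnlineAlg public

onlineCostFrom : ∀ {n m} → OnlineAlg n m → Config n m → List (Request n)
               → List (Request n) → ℕ
onlineCostFrom A prev h [] = 0
onlineCostFrom A prev h (r ∷ σ) =
  changeCost prev (step A (r ∷ h)) + onlineCostFrom A (step A (r ∷ h)) (r ∷ h) σ

onlineCost : ∀ {n m} → OnlineAlg n m → List (Request n) → ℕ
onlineCost A σ = onlineCostFrom A emptyConfig [] σ

Feasible : ∀ {n k} → List (Request n) → List (Config n k) → Set
Feasible σ S = Pointwise (λ r C → r ∈C C) σ S

scheduleCostFrom : ∀ {n k} → Config n k → List (Config n k) → ℕ
scheduleCostFrom prev [] = 0
scheduleCostFrom prev (C ∷ S) = changeCost prev C + scheduleCostFrom C S

scheduleCost : ∀ {n k} → List (Config n k) → ℕ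
scheduleCost S = scheduleCostFrom emptyConfig S

-- A is c-competitive against offline solutions with k matchings:
-- cost(A σ) ≤ c · cost(OPT σ) + d for all σ, where OPT ranges over all
-- feasible offline schedules (so this is ≤ c·OPT + d for the optimum).
Competitive : ∀ {n m} → ℕ → (k : ℕ) → OnlineAlg n m → Set
Competitive {n} c k A =
  Σ ℕ λ d → ∀ (σ : List (Request n)) (S : List (Config n k)) →
    Feasible σ S → onlineCost A σ ≤ c * scheduleCost S + d

{-# OPTIONS --safe #-}
-- On a request {u,v} missing from the cache, the algorithm flushes each endpoint
-- whose cached degree is at least D = ⌈m/2⌉ (removing all cached edges at it) and
-- then inserts {u,v} into a matching free at both endpoints; one exists because
-- both degrees are now below D and 2D ≤ m + 1.  So every miss costs 1.
--
-- For the analysis, each node u records the arcs (u,v) that have been in OPT's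
-- cache since u was last flushed, together with a snapshot of OPT's (at most k)
-- arcs at u taken at that flush.  Recorded arcs outside the snapshot were inserted
-- by OPT, so their number, the excess, grows by at most twice OPT's cost.  When u
-- is flushed on a request (u,t), the cached arcs at u and (u,t) are distinct
-- recorded arcs (no arc is cached twice), hence deg u + 1 ≤ excess u + k, which
-- together with deg u ≥ D ≥ (3k − 3)/2 gives deg u ≤ 3 · excess u.  With the
-- potential Φ = 6 · excess − (cached arcs) every step then satisfies
-- 2 · cost + ΔΦ ≤ 12 · OPT's cost, which sums to cost ≤ 6 · OPT + const.
module Submission where

open import Defs
open import Data.Bool using (Bool; true; false; _∧_; _∨_; not)
open import Data.Bool.Properties using (∧-zeroʳ; ∧-identityʳ; ∧-inverseʳ; ∨-zeroʳ) renaming (_≟_ to _≟ᵇ_)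
open import Data.Empty using (⊥; ⊥-elim)
open import Data.Fin using (Fin; zero; suc; toℕ; fromℕ<; punchIn)
open import Data.Fin.Properties using (_≟_; any?; punchInᵢ≢i; toℕ-injective)
open import Data.List using (List; []; _∷_; map; allFin; tabulate)
open import Data.List.Properties using (map-tabulate)
open import Data.List.Relation.Binary.Pointwise using ([]; _∷_)
open import Data.Maybe using (Maybe; just; nothing)
open import Data.Maybe.Properties using (≡-dec; just-injective)
open import Function.Bundles using (mk⇔)
open import Data.Nat using (ℕ; zero; suc; _+_; _*_; _∸_; _≤_; _<_; _≤?_; z≤n; s≤s; ⌈_/2⌉)
open import Data.Nat.Properties hiding (_≟_)
open import Data.Nat.Tactic.RingSolver using (solve-∀)
import Data.Nat.ListAction as List
open import Data.Product using (Σ; ∃; _×_; _,_; proj₁; proj₂)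
open import Data.Sum using (_⊎_; inj₁; inj₂)
open import Function using (_∘_; _$_; id)
open import Relation.Binary.PropositionalEquality
open import Relation.Nullary using (¬_; Dec; yes; no; does)
open import Relation.Nullary.Decidable using (⌊_⌋; _×-dec_; dec-true; dec-false; does-⇔)

open import Algebra.Properties.Semiring.Sum +-*-semiring
  using (sum; sum-cong-≗; sum-remove; sum-replicate-zero; ∑-distrib-+; ∑-comm; *-distribˡ-sum)

-- Sums over finite index sets

χ : Bool → ℕ
χ true = 1
χ false = 0

χ≤1 : ∀ b → χ b ≤ 1
χ≤1 true = ≤-refl
χ≤1 false = z≤n

χ-mono : ∀ {a b} → (a ≡ true → b ≡ true) → χ a ≤ χ b
χ-mono {false} _ = z≤n
χ-mono {true} a⇒b rewrite a⇒b refl = ≤-refl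

does-true : ∀ {p} {P : Set p} (p? : Dec P) → does p? ≡ true → P
does-true (yes p) _ = p

list-sum-allFin : ∀ {a} (f : Fin a → ℕ) → List.sum (map f (allFin a)) ≡ sum f
list-sum-allFin {a} f = trans (cong List.sum (map-tabulate id f)) (sum-tabulate f)
  where
  sum-tabulate : ∀ {a} (f : Fin a → ℕ) → List.sum (tabulate f) ≡ sum f
  sum-tabulate {zero} f = refl
  sum-tabulate {suc a} f = cong (f zero +_) (sum-tabulate (f ∘ suc))

∑-mono-≤ : ∀ {a} {f g : Fin a → ℕ} → (∀ i → f i ≤ g i) → sum f ≤ sum g
∑-mono-≤ {zero} f≤g = z≤n
∑-mono-≤ {suc a} f≤g = +-mono-≤ (f≤g zero) (∑-mono-≤ (f≤g ∘ suc))

∑-zero : ∀ {a} {f : Fin a → ℕ} → (∀ i → f i ≡ 0) → sum f ≡ 0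
∑-zero {a} f≗0 = trans (sum-cong-≗ f≗0) (sum-replicate-zero a)

∑-one : ∀ a → sum {a} (λ _ → 1) ≡ a
∑-one zero = refl
∑-one (suc a) = cong suc (∑-one a)

∑-pointAt : ∀ {a} (f : Fin a → ℕ) (w : Fin a) → (∀ i → i ≢ w → f i ≡ 0) → sum f ≡ f w
∑-pointAt {suc a} f w f≗0 = begin
  sum f                           ≡⟨ sum-remove {i = w} f ⟩
  f w + sum (f ∘ punchIn w)       ≡⟨ cong (f w +_) (∑-zero (λ j → f≗0 _ (punchInᵢ≢i w j))) ⟩
  f w + 0                         ≡⟨ +-identityʳ (f w) ⟩
  f w                             ∎
  where open ≡-Reasoning

term≤∑ : ∀ {a} (f : Fin a → ℕ) (w : Fin a) → f w ≤ sum f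
term≤∑ {suc a} f w = ≤-trans (m≤m+n (f w) _) (≤-reflexive (sym (sum-remove {i = w} f)))

∑-dropAt : ∀ {a} (f g : Fin a → ℕ) (w : Fin a) → (∀ i → i ≢ w → f i ≡ g i) → g w ≡ 0 →
           sum g + f w ≡ sum f
∑-dropAt {suc a} f g w f≗g gw≡0 = begin
  sum g + f w                     ≡⟨ cong (_+ f w) (sum-remove {i = w} g) ⟩
  (g w + sum (g ∘ punchIn w)) + f w  ≡⟨ cong₂ (λ x y → (x + y) + f w) gw≡0 (sym rest) ⟩
  sum (f ∘ punchIn w) + f w       ≡⟨ +-comm _ (f w) ⟩
  f w + sum (f ∘ punchIn w)       ≡⟨ sum-remove {i = w} f ⟨
  sum f                           ∎
  where
  open ≡-Reasoning
  rest : sum (f ∘ punchIn w) ≡ sum (g ∘ punchIn w)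
  rest = sum-cong-≗ (λ j → f≗g _ (punchInᵢ≢i w j))

∑-raiseAt : ∀ {a} (f g : Fin a → ℕ) (w : Fin a) {d} → (∀ i → i ≢ w → f i ≡ g i) → f w + d ≤ g w →
            sum f + d ≤ sum g
∑-raiseAt {suc a} f g w {d} f≗g raise = begin
  sum f + d                              ≡⟨ cong (_+ d) (sum-remove {i = w} f) ⟩
  f w + sum (f ∘ punchIn w) + d          ≡⟨ +-assoc (f w) _ d ⟩
  f w + (sum (f ∘ punchIn w) + d)        ≡⟨ cong (f w +_) (+-comm _ d) ⟩
  f w + (d + sum (f ∘ punchIn w))        ≡⟨ +-assoc (f w) d _ ⟨
  f w + d + sum (f ∘ punchIn w)          ≤⟨ +-mono-≤ raise (≤-reflexive rest) ⟩
  g w + sum (g ∘ punchIn w)              ≡⟨ sum-remove {i = w} g ⟨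
  sum g                                  ∎
  where
  open ≤-Reasoning
  rest : sum (f ∘ punchIn w) ≡ sum (g ∘ punchIn w)
  rest = sum-cong-≗ (λ j → f≗g _ (punchInᵢ≢i w j))

∑χ-unique : ∀ {a} (b : Fin a → Bool) → (∀ i j → b i ≡ true → b j ≡ true → i ≡ j) →
            sum (χ ∘ b) ≤ 1
∑χ-unique b unique with any? (λ i → b i ≟ᵇ true)
... | yes (w , bw) = ≤-trans (≤-reflexive (∑-pointAt (χ ∘ b) w others)) (χ≤1 (b w))
  where
  others : ∀ i → i ≢ w → χ (b i) ≡ 0
  others i i≢w with b i in bi
  ... | true = ⊥-elim (i≢w (unique i w bi bw))
  ... | false = refl
... | no none = ≤-trans (≤-reflexive (∑-zero absent)) z≤n
  where
  absent : ∀ i → χ (b i) ≡ 0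
  absent i with b i in bi
  ... | true = ⊥-elim (none (i , bi))
  ... | false = refl

δ : ∀ {a} → Fin a → Fin a → Bool
δ i j = does (i ≟ j)

∑δ : ∀ {a} (w : Fin a) → sum (λ i → χ (δ i w)) ≡ 1
∑δ w = trans (∑-pointAt _ w (λ i i≢w → cong χ (dec-false (i ≟ w) i≢w))) (cong χ (dec-true (w ≟ w) refl))

∑∑ : ∀ {a b} → (Fin a → Fin b → ℕ) → ℕ
∑∑ f = sum (λ x → sum (f x))

∑∑-mono-≤ : ∀ {a b} {f g : Fin a → Fin b → ℕ} → (∀ x y → f x y ≤ g x y) → ∑∑ f ≤ ∑∑ g
∑∑-mono-≤ f≤g = ∑-mono-≤ (λ x → ∑-mono-≤ (f≤g x))

∑∑-distrib-+ : ∀ {a b} (f g : Fin a → Fin b → ℕ) → ∑∑ (λ x y → f x y + g x y) ≡ ∑∑ f + ∑∑ g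
∑∑-distrib-+ f g =
  trans (sum-cong-≗ (λ x → ∑-distrib-+ (f x) (g x))) (∑-distrib-+ (λ x → sum (f x)) (λ x → sum (g x)))

∑-δ∧ : ∀ {a} (b : Fin a → Bool) (w : Fin a) → sum (λ x → χ (δ x w ∧ b x)) ≡ χ (b w)
∑-δ∧ b w = trans (∑-pointAt _ w (λ x x≢w → cong (λ t → χ (t ∧ b x)) (dec-false (x ≟ w) x≢w)))
                 (cong (λ t → χ (t ∧ b w)) (dec-true (w ≟ w) refl))

∑∑-δ : ∀ {a b} (x₀ : Fin a) (y₀ : Fin b) → ∑∑ (λ x y → χ (δ x x₀ ∧ δ y y₀)) ≡ 1
∑∑-δ x₀ y₀ = trans (∑-comm (λ x y → χ (δ x x₀ ∧ δ y y₀)))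
                   (trans (sum-cong-≗ (λ y → ∑-δ∧ (λ _ → δ y y₀) x₀)) (∑δ y₀))

module _ {n : ℕ} where

  edge? : (M : Matching n) (u v : Fin n) → Dec (mate M u ≡ just v)
  edge? M u v = ≡-dec _≟_ (mate M u) (just v)

  edge : Matching n → Fin n → Fin n → Bool
  edge M u v = does (edge? M u v)

  edge⇒mate : ∀ M u v → edge M u v ≡ true → mate M u ≡ just v
  edge⇒mate M u v = does-true (edge? M u v)

  mate⇒edge : ∀ M u v → mate M u ≡ just v → edge M u v ≡ true
  mate⇒edge M u v = dec-true (edge? M u v)

  edge-sym : ∀ M u v → edge M u v ≡ edge M v u
  edge-sym M u v = does-⇔ (mk⇔ (mate-sym M u v) (mate-sym M v u)) (edge? M u v) (edge? M v u)

  edge-irrefl : ∀ M u → edge M u u ≡ false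
  edge-irrefl M u = dec-false (edge? M u u) (mate-irr M u)

  free⇒¬edge : ∀ M u v → mate M u ≡ nothing → edge M u v ≡ false
  free⇒¬edge M u v free = dec-false (edge? M u v) (λ eq → nothing≢just (trans (sym free) eq))
    where
    nothing≢just : ∀ {x : Fin n} → nothing ≢ just x
    nothing≢just ()

  degree : Matching n → Fin n → ℕ
  degree M u = sum (λ v → χ (edge M u v))

  degree≤1 : ∀ M u → degree M u ≤ 1
  degree≤1 M u = ∑χ-unique (edge M u)
    (λ v w uv uw → just-injective (trans (sym (edge⇒mate M u v uv)) (edge⇒mate M u w uw)))

  busy⇒degree≥1 : ∀ (M : Matching n) u w → mate M u ≡ just w → 1 ≤ degree M u
  busy⇒degree≥1 M u w uw =
    ≤-trans (≤-reflexive (cong χ (sym (mate⇒edge M u w uw)))) (term≤∑ (λ y → χ (edge M u y)) w)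

  arcs : Matching n → ℕ
  arcs M = ∑∑ (λ x y → χ (edge M x y))

  mate-∖ : Matching n → Fin n → Fin n → Maybe (Fin n)
  mate-∖ M u w with w ≟ u | edge? M w u
  ... | yes _ | _     = nothing
  ... | no _  | yes _ = nothing
  ... | no _  | no _  = mate M w

  mate-∖-just : ∀ M u w x → mate-∖ M u w ≡ just x → w ≢ u × x ≢ u × mate M w ≡ just x
  mate-∖-just M u w x eq with w ≟ u | edge? M w u
  mate-∖-just M u w x () | yes _ | _
  mate-∖-just M u w x () | no _ | yes _
  ... | no w≢u | no ¬wu = w≢u , (λ { refl → ¬wu eq }) , eq

  mate-∖-keep : ∀ M u w x → w ≢ u → x ≢ u → mate M w ≡ just x → mate-∖ M u w ≡ just x
  mate-∖-keep M u w x w≢u x≢u wx with w ≟ u | edge? M w u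
  ... | yes w≡u | _ = ⊥-elim (w≢u w≡u)
  ... | no _ | yes wu = ⊥-elim (x≢u (just-injective (trans (sym wx) wu)))
  ... | no _ | no _ = wx

  infixl 6 _∖_
  _∖_ : Matching n → Fin n → Matching n
  M ∖ u = record { mate = mate-∖ M u ; mate-sym = symmetric ; mate-irr = irreflexive }
    where
    symmetric : ∀ w x → mate-∖ M u w ≡ just x → mate-∖ M u x ≡ just w
    symmetric w x wx with mate-∖-just M u w x wx
    ... | w≢u , x≢u , wx′ = mate-∖-keep M u x w x≢u w≢u (mate-sym M w x wx′)
    irreflexive : ∀ w → mate-∖ M u w ≢ just w
    irreflexive w ww = mate-irr M w (proj₂ (proj₂ (mate-∖-just M u w w ww)))

  ∖-free : ∀ M u → mate (M ∖ u) u ≡ nothing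
  ∖-free M u with u ≟ u
  ... | yes _ = refl
  ... | no u≢u = ⊥-elim (u≢u refl)

  ∖-preserves-free : ∀ M u w → mate M w ≡ nothing → mate (M ∖ u) w ≡ nothing
  ∖-preserves-free M u w free with mate-∖ M u w in eq
  ... | nothing = refl
  ... | just x = trans (sym (proj₂ (proj₂ (mate-∖-just M u w x eq)))) free

  ∖-⊆ : ∀ M u x y → edge (M ∖ u) x y ≡ true → edge M x y ≡ true
  ∖-⊆ M u x y xy = mate⇒edge M x y (proj₂ (proj₂ (mate-∖-just M u x y (edge⇒mate (M ∖ u) x y xy))))

  ∖-row : ∀ M u y → edge (M ∖ u) u y ≡ false
  ∖-row M u y = free⇒¬edge (M ∖ u) u y (∖-free M u)

  ∖-keep : ∀ M u x y → x ≢ u → y ≢ u → edge M x y ≡ true → edge (M ∖ u) x y ≡ true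
  ∖-keep M u x y x≢u y≢u xy = mate⇒edge (M ∖ u) x y (mate-∖-keep M u x y x≢u y≢u (edge⇒mate M x y xy))

  mate-+ : Matching n → Fin n → Fin n → Fin n → Maybe (Fin n)
  mate-+ M u v w with w ≟ u | w ≟ v
  ... | yes _ | _     = just v
  ... | no _  | yes _ = just u
  ... | no _  | no _  = mate M w

  mate-+-u : ∀ M u v → mate-+ M u v u ≡ just v
  mate-+-u M u v with u ≟ u
  ... | yes _ = refl
  ... | no u≢u = ⊥-elim (u≢u refl)

  mate-+-v : ∀ M u v → u ≢ v → mate-+ M u v v ≡ just u
  mate-+-v M u v u≢v with v ≟ u | v ≟ v
  ... | yes v≡u | _ = ⊥-elim (u≢v (sym v≡u))
  ... | no _ | yes _ = refl
  ... | no _ | no v≢v = ⊥-elim (v≢v refl)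

  mate-+-other : ∀ M u v w → w ≢ u → w ≢ v → mate-+ M u v w ≡ mate M w
  mate-+-other M u v w w≢u w≢v with w ≟ u | w ≟ v
  ... | yes w≡u | _ = ⊥-elim (w≢u w≡u)
  ... | no _ | yes w≡v = ⊥-elim (w≢v w≡v)
  ... | no _ | no _ = refl

  data AddedArc (M : Matching n) (u v w x : Fin n) : Set where
    arc-uv  : w ≡ u → x ≡ v → AddedArc M u v w x
    arc-vu  : w ≡ v → x ≡ u → AddedArc M u v w x
    arc-old : w ≢ u → w ≢ v → edge M w x ≡ true → AddedArc M u v w x

  mate-+-just : ∀ M u v w x → mate-+ M u v w ≡ just x → AddedArc M u v w x
  mate-+-just M u v w x eq with w ≟ u | w ≟ v
  mate-+-just M u v w x refl | yes w≡u | _ = arc-uv w≡u refl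
  mate-+-just M u v w x refl | no _ | yes w≡v = arc-vu w≡v refl
  ... | no w≢u | no w≢v = arc-old w≢u w≢v (mate⇒edge M w x eq)

  module _ (M : Matching n) {u v : Fin n} (u≢v : u ≢ v)
           (u-free : mate M u ≡ nothing) (v-free : mate M v ≡ nothing) where

    mate-avoids-free : ∀ {w x} → mate M w ≡ just x → x ≢ u × x ≢ v
    mate-avoids-free wx = (λ { refl → absurd u-free (mate-sym M _ _ wx) })
                  , (λ { refl → absurd v-free (mate-sym M _ _ wx) })
      where
      absurd : ∀ {y : Maybe (Fin n)} {w} → y ≡ nothing → y ≡ just w → ⊥
      absurd refl ()

    addFree : Matching n
    addFree = record { mate = mate-+ M u v ; mate-sym = symmetric ; mate-irr = irreflexive }
      where
      symmetric : ∀ w x → mate-+ M u v w ≡ just x → mate-+ M u v x ≡ just w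
      symmetric w x wx with mate-+-just M u v w x wx
      ... | arc-uv refl refl = mate-+-v M u v u≢v
      ... | arc-vu refl refl = mate-+-u M u v
      ... | arc-old _ _ wx′ with mate-avoids-free (edge⇒mate M w x wx′)
      ...   | x≢u , x≢v = trans (mate-+-other M u v x x≢u x≢v) (mate-sym M w x (edge⇒mate M w x wx′))
      irreflexive : ∀ w → mate-+ M u v w ≢ just w
      irreflexive w ww with mate-+-just M u v w w ww
      ... | arc-uv refl refl = u≢v refl
      ... | arc-vu refl refl = u≢v refl
      ... | arc-old _ _ ww′ = mate-irr M w (edge⇒mate M w w ww′)

  insert : (M : Matching n) (u v : Fin n) → u ≢ v → Matching n
  insert M u v u≢v = addFree (M ∖ u ∖ v) u≢v (∖-preserves-free (M ∖ u) v u (∖-free M u)) (∖-free (M ∖ u) v)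

  insert-uv : ∀ M u v u≢v → edge (insert M u v u≢v) u v ≡ true
  insert-uv M u v u≢v = mate⇒edge (insert M u v u≢v) u v (mate-+-u (M ∖ u ∖ v) u v)

  insert-arc : ∀ M u v u≢v x y → edge (insert M u v u≢v) x y ≡ true → AddedArc M u v x y
  insert-arc M u v u≢v x y xy with mate-+-just (M ∖ u ∖ v) u v x y (edge⇒mate (insert M u v u≢v) x y xy)
  ... | arc-uv x≡u y≡v = arc-uv x≡u y≡v
  ... | arc-vu x≡v y≡u = arc-vu x≡v y≡u
  ... | arc-old x≢u x≢v xy′ = arc-old x≢u x≢v (∖-⊆ M u x y (∖-⊆ (M ∖ u) v x y xy′))

  insert-keep : ∀ M u v u≢v → mate M u ≡ nothing → mate M v ≡ nothing →
                ∀ x y → edge M x y ≡ true → edge (insert M u v u≢v) x y ≡ true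
  insert-keep M u v u≢v u-free v-free x y xy =
    mate⇒edge (insert M u v u≢v) x y (trans (mate-+-other (M ∖ u ∖ v) u v x x≢u x≢v) kept)
    where
    x≢u×x≢v : x ≢ u × x ≢ v
    x≢u×x≢v = mate-avoids-free M u≢v u-free v-free (mate-sym M x y (edge⇒mate M x y xy))
    y≢u×y≢v : y ≢ u × y ≢ v
    y≢u×y≢v = mate-avoids-free M u≢v u-free v-free (edge⇒mate M x y xy)
    x≢u = proj₁ x≢u×x≢v
    x≢v = proj₂ x≢u×x≢v
    kept : mate (M ∖ u ∖ v) x ≡ just y
    kept = edge⇒mate (M ∖ u ∖ v) x y
      (∖-keep (M ∖ u) v x y x≢v (proj₂ y≢u×y≢v) (∖-keep M u x y x≢u (proj₁ y≢u×y≢v) xy))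

  arcs-∖ : ∀ M u → arcs M ≤ arcs (M ∖ u) + 2 * degree M u
  arcs-∖ M u = begin
    arcs M                                                ≤⟨ ∑∑-mono-≤ split ⟩
    ∑∑ (λ x y → χ (edge (M ∖ u) x y) + (atRow x y + atCol x y))
      ≡⟨ ∑∑-distrib-+ (λ x y → χ (edge (M ∖ u) x y)) _ ⟩
    arcs (M ∖ u) + ∑∑ (λ x y → atRow x y + atCol x y)     ≡⟨ cong (arcs (M ∖ u) +_) (∑∑-distrib-+ atRow atCol) ⟩
    arcs (M ∖ u) + (∑∑ atRow + ∑∑ atCol)                  ≡⟨ cong (arcs (M ∖ u) +_) (cong₂ _+_ row col) ⟩
    arcs (M ∖ u) + 2 * degree M u                         ∎
    where
    open ≤-Reasoning
    atRow atCol : Fin n → Fin n → ℕ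
    atRow x y = χ (δ x u ∧ edge M x y)
    atCol x y = χ (δ y u ∧ edge M x y)
    split : ∀ x y → χ (edge M x y) ≤ χ (edge (M ∖ u) x y) + (atRow x y + atCol x y)
    split x y with edge M x y in xy
    ... | false = z≤n
    ... | true = cases (x ≟ u) (y ≟ u)
      where
      cases : (x? : Dec (x ≡ u)) (y? : Dec (y ≡ u)) →
              1 ≤ χ (edge (M ∖ u) x y) + (χ (does x? ∧ true) + χ (does y? ∧ true))
      cases (yes _) y? = ≤-trans (m≤m+n 1 (χ (does y? ∧ true))) (m≤n+m _ (χ (edge (M ∖ u) x y)))
      cases (no _) (yes _) = m≤n+m 1 (χ (edge (M ∖ u) x y))
      cases (no x≢u) (no y≢u) rewrite ∖-keep M u x y x≢u y≢u xy = m≤m+n 1 _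
    row : ∑∑ atRow ≡ degree M u
    row = trans (∑-comm atRow) (sum-cong-≗ (λ y → ∑-δ∧ (λ x → edge M x y) u))
    col : ∑∑ atCol ≡ degree M u + 0
    col = begin-equality
      ∑∑ atCol                          ≡⟨ sum-cong-≗ (λ x → ∑-δ∧ (edge M x) u) ⟩
      sum (λ x → χ (edge M x u))        ≡⟨ sum-cong-≗ (λ x → cong χ (edge-sym M x u)) ⟩
      degree M u                        ≡⟨ +-identityʳ _ ⟨
      degree M u + 0                    ∎

  pairArcs : Fin n → Fin n → Fin n → Fin n → ℕ
  pairArcs u v x y = χ (δ x u ∧ δ y v) + χ (δ x v ∧ δ y u)

  ∑∑-pairArcs : ∀ u v → ∑∑ (pairArcs u v) ≡ 2
  ∑∑-pairArcs u v = trans (∑∑-distrib-+ (λ x y → χ (δ x u ∧ δ y v)) (λ x y → χ (δ x v ∧ δ y u)))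
                          (cong₂ _+_ (∑∑-δ u v) (∑∑-δ v u))

  arcs-insert : ∀ M {u v} (u≢v : u ≢ v) → mate M u ≡ nothing → mate M v ≡ nothing →
                arcs M + 2 ≤ arcs (insert M u v u≢v)
  arcs-insert M {u} {v} u≢v u-free v-free = begin
    arcs M + 2                                   ≡⟨ cong (arcs M +_) (∑∑-pairArcs u v) ⟨
    arcs M + ∑∑ (pairArcs u v)                   ≡⟨ ∑∑-distrib-+ (λ x y → χ (edge M x y)) (pairArcs u v) ⟨
    ∑∑ (λ x y → χ (edge M x y) + pairArcs u v x y) ≤⟨ ∑∑-mono-≤ pointwise ⟩
    arcs N                                       ∎
    where
    open ≤-Reasoning
    N = insert M u v u≢v
    pointwise : ∀ x y → χ (edge M x y) + pairArcs u v x y ≤ χ (edge N x y)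
    pointwise x y with edge M x y in xy
    ... | true with mate-avoids-free M u≢v u-free v-free (mate-sym M x y (edge⇒mate M x y xy))
    ...   | x≢u , x≢v rewrite insert-keep M u v u≢v u-free v-free x y xy
                            | dec-false (x ≟ u) x≢u | dec-false (x ≟ v) x≢v = ≤-refl
    pointwise x y | false = cases (x ≟ u) (y ≟ v) (x ≟ v) (y ≟ u)
      where
      cases : (xu? : Dec (x ≡ u)) (yv? : Dec (y ≡ v)) (xv? : Dec (x ≡ v)) (yu? : Dec (y ≡ u)) →
              χ (does xu? ∧ does yv?) + χ (does xv? ∧ does yu?) ≤ χ (edge N x y)
      cases (yes refl) (yes refl) (yes u≡v) _ = ⊥-elim (u≢v u≡v)
      cases (yes refl) (yes refl) (no _) _ rewrite insert-uv M u v u≢v = ≤-refl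
      cases (yes refl) (no _) (yes u≡v) _ = ⊥-elim (u≢v u≡v)
      cases (yes refl) (no _) (no _) _ = z≤n
      cases (no _) _ (no _) _ = z≤n
      cases (no _) _ (yes refl) (no _) = z≤n
      cases (no _) _ (yes refl) (yes refl) rewrite edge-sym N v u | insert-uv M u v u≢v = ≤-refl

  newArcs : Matching n → Matching n → ℕ
  newArcs old new = ∑∑ (λ x y → χ (edge new x y ∧ not (edge old x y)))

  newArcs-⊆ : ∀ old new → (∀ x y → edge new x y ≡ true → edge old x y ≡ true) → newArcs old new ≡ 0
  newArcs-⊆ old new new⊆old = ∑-zero (λ x → ∑-zero (pointwise x))
    where
    pointwise : ∀ x y → χ (edge new x y ∧ not (edge old x y)) ≡ 0
    pointwise x y with edge new x y in xy
    ... | false = refl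
    ... | true rewrite new⊆old x y xy = refl

  newArcs-insert : ∀ M₀ M u v u≢v → (∀ x y → edge M x y ≡ true → edge M₀ x y ≡ true) →
                   newArcs M₀ (insert M u v u≢v) ≤ 2
  newArcs-insert M₀ M u v u≢v M⊆M₀ = begin
    newArcs M₀ (insert M u v u≢v) ≤⟨ ∑∑-mono-≤ pointwise ⟩
    ∑∑ (pairArcs u v)            ≡⟨ ∑∑-pairArcs u v ⟩
    2                            ∎
    where
    open ≤-Reasoning
    pointwise : ∀ x y → χ (edge (insert M u v u≢v) x y ∧ not (edge M₀ x y)) ≤ pairArcs u v x y
    pointwise x y with edge (insert M u v u≢v) x y in xy
    ... | false = z≤n
    ... | true with insert-arc M u v u≢v x y xy
    ...   | arc-old _ _ old rewrite M⊆M₀ x y old = z≤n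
    ...   | arc-uv refl refl rewrite dec-true (x ≟ x) refl | dec-true (y ≟ y) refl =
              ≤-trans (χ≤1 _) (m≤m+n 1 _)
    ...   | arc-vu refl refl rewrite dec-true (x ≟ x) refl | dec-true (y ≟ y) refl =
              ≤-trans (χ≤1 _) (m≤n+m 1 _)

  precedes : Fin n → Fin n → Bool
  precedes u v = ⌊ toℕ u <? toℕ v ⌋

  newArc : Matching n → Matching n → Fin n → Fin n → Bool
  newArc old new x y = edge new x y ∧ not (edge old x y)

  precedes-off : ∀ old u w v → v ≢ w →
                 χ (precedes u v ∧ does (≡-dec _≟_ (just w) (just v)) ∧ not (edge old u v)) ≡ 0
  precedes-off old u w v v≢w rewrite dec-false (w ≟ v) (v≢w ∘ sym) = cong χ (∧-zeroʳ (precedes u v))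

  addedAt≡∑ : ∀ old new u → addedAt old new u ≡ sum (λ v → χ (precedes u v ∧ newArc old new u v))
  addedAt≡∑ old new u with mate new u
  ... | nothing = sym (∑-zero (λ v → cong χ (∧-zeroʳ (precedes u v))))
  ... | just w rewrite ∑-pointAt _ w (precedes-off old u w) | dec-true (w ≟ w) refl
    with toℕ u <? toℕ w
  ...   | no _ = refl
  ...   | yes _ with edge? old u w
  ...     | yes _ = refl
  ...     | no _ = refl

  precedes-split : ∀ x y b → (x ≡ y → b ≡ false) → χ (precedes x y ∧ b) + χ (precedes y x ∧ b) ≡ χ b
  precedes-split x y b x≡y⇒¬b with toℕ x <? toℕ y | toℕ y <? toℕ x
  ... | yes x<y | yes y<x = ⊥-elim (<-asym x<y y<x)
  ... | yes _ | no _ = +-identityʳ (χ b)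
  ... | no _ | yes _ = refl
  ... | no x≮y | no y≮x rewrite x≡y⇒¬b (toℕ-injective (≤-antisym (≮⇒≥ y≮x) (≮⇒≥ x≮y))) = refl

  addedM≡∑∑ : ∀ old new → addedM old new ≡ ∑∑ (λ x y → χ (precedes x y ∧ newArc old new x y))
  addedM≡∑∑ old new = trans (list-sum-allFin (addedAt old new)) (sum-cong-≗ (addedAt≡∑ old new))

  -- addedM charges each new edge once, at its endpoint of smaller index.
  twice-addedM : ∀ old new → 2 * addedM old new ≡ newArcs old new
  twice-addedM old new = begin
    2 * addedM old new                    ≡⟨ cong₂ (λ a b → a + (b + 0)) (addedM≡∑∑ old new) (addedM≡∑∑ old new) ⟩
    ∑∑ forward + (∑∑ forward + 0)         ≡⟨ cong (∑∑ forward +_) (trans (+-identityʳ _) (∑-comm forward)) ⟩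
    ∑∑ forward + ∑∑ (λ x y → forward y x) ≡⟨ ∑∑-distrib-+ forward (λ x y → forward y x) ⟨
    ∑∑ (λ x y → forward x y + forward y x) ≡⟨ sum-cong-≗ (λ x → sum-cong-≗ (λ y → bothWays x y)) ⟩
    newArcs old new                       ∎
    where
    open ≡-Reasoning
    forward : Fin n → Fin n → ℕ
    forward x y = χ (precedes x y ∧ newArc old new x y)
    bothWays : ∀ x y → forward x y + forward y x ≡ χ (newArc old new x y)
    bothWays x y rewrite edge-sym new y x | edge-sym old y x =
      precedes-split x y (newArc old new x y) (λ { refl → cong (_∧ _) (edge-irrefl new x) })

module _ {n m : ℕ} where

  deg : Config n m → Fin n → ℕ
  deg C u = sum (λ i → degree (C i) u)

  cacheArcs : Config n m → ℕ
  cacheArcs C = sum (λ i → arcs (C i))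

  _⊆ᶜ_ : Config n m → Config n m → Set
  C ⊆ᶜ C′ = ∀ i x y → edge (C i) x y ≡ true → edge (C′ i) x y ≡ true

  cached? : (C : Config n m) (u v : Fin n) → Dec (∃ λ i → mate (C i) u ≡ just v)
  cached? C u v = any? (λ i → edge? (C i) u v)

  cached : Config n m → Fin n → Fin n → Bool
  cached C u v = does (cached? C u v)

  cached-intro : ∀ C u v i → edge (C i) u v ≡ true → cached C u v ≡ true
  cached-intro C u v i uv = dec-true (cached? C u v) (i , edge⇒mate (C i) u v uv)

  cached-elim : ∀ C u v → cached C u v ≡ true → ∃ λ i → edge (C i) u v ≡ true
  cached-elim C u v uv with does-true (cached? C u v) uv
  ... | i , mate-uv = i , mate⇒edge (C i) u v mate-uv

  cached-sym : ∀ C u v → cached C u v ≡ true → cached C v u ≡ true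
  cached-sym C u v uv with cached-elim C u v uv
  ... | i , uv′ = cached-intro C v u i (trans (sym (edge-sym (C i) u v)) uv′)

  cached-row≤ : ∀ C u → sum (λ v → χ (cached C u v)) ≤ m
  cached-row≤ C u = begin
    sum (λ v → χ (cached C u v))              ≤⟨ ∑-mono-≤ someMatching ⟩
    sum (λ v → sum (λ i → χ (edge (C i) u v))) ≡⟨ ∑-comm (λ v i → χ (edge (C i) u v)) ⟩
    deg C u                                   ≤⟨ ∑-mono-≤ (λ i → degree≤1 (C i) u) ⟩
    sum {m} (λ _ → 1)                         ≡⟨ ∑-one m ⟩
    m                                         ∎
    where
    open ≤-Reasoning
    someMatching : ∀ v → χ (cached C u v) ≤ sum (λ i → χ (edge (C i) u v))
    someMatching v with cached C u v in uv
    ... | false = z≤n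
    ... | true with cached-elim C u v uv
    ...   | i , uv′ = ≤-trans (≤-reflexive (cong χ (sym uv′))) (term≤∑ (λ i → χ (edge (C i) u v)) i)

  twice-changeCost : ∀ (C C′ : Config n m) → 2 * changeCost C C′ ≡ sum (λ i → newArcs (C i) (C′ i))
  twice-changeCost C C′ = begin
    2 * changeCost C C′                          ≡⟨ cong (2 *_) (list-sum-allFin (λ i → addedM (C i) (C′ i))) ⟩
    2 * sum (λ i → addedM (C i) (C′ i))          ≡⟨ *-distribˡ-sum 2 (λ i → addedM (C i) (C′ i)) ⟩
    sum (λ i → 2 * addedM (C i) (C′ i))          ≡⟨ sum-cong-≗ (λ i → twice-addedM (C i) (C′ i)) ⟩
    sum (λ i → newArcs (C i) (C′ i))             ∎
    where open ≡-Reasoning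

  changeCost-⊆ : ∀ (C C′ : Config n m) → C′ ⊆ᶜ C → changeCost C C′ ≡ 0
  changeCost-⊆ C C′ C′⊆C = *-cancelˡ-≡ (changeCost C C′) 0 2 (trans (twice-changeCost C C′)
    (∑-zero (λ i → newArcs-⊆ (C i) (C′ i) (C′⊆C i))))

  _∖ᶜ_ : Config n m → Fin n → Config n m
  (C ∖ᶜ u) i = C i ∖ u

  ∖ᶜ-⊆ : ∀ C u → (C ∖ᶜ u) ⊆ᶜ C
  ∖ᶜ-⊆ C u i = ∖-⊆ (C i) u

  deg-∖ᶜ : ∀ C u → deg (C ∖ᶜ u) u ≡ 0
  deg-∖ᶜ C u = ∑-zero (λ i → ∑-zero (λ y → cong χ (∖-row (C i) u y)))

  cacheArcs-∖ᶜ : ∀ C u → cacheArcs C ≤ cacheArcs (C ∖ᶜ u) + 2 * deg C u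
  cacheArcs-∖ᶜ C u = begin
    cacheArcs C                                              ≤⟨ ∑-mono-≤ (λ i → arcs-∖ (C i) u) ⟩
    sum (λ i → arcs (C i ∖ u) + 2 * degree (C i) u)         ≡⟨ ∑-distrib-+ (λ i → arcs (C i ∖ u)) _ ⟩
    cacheArcs (C ∖ᶜ u) + sum (λ i → 2 * degree (C i) u)     ≡⟨ cong (cacheArcs (C ∖ᶜ u) +_) (*-distribˡ-sum 2 (λ i → degree (C i) u)) ⟨
    cacheArcs (C ∖ᶜ u) + 2 * deg C u                        ∎
    where open ≤-Reasoning

  ⊆ᶜ-missing : ∀ F C → F ⊆ᶜ C → ∀ i u v → edge (C i) u v ≡ false → edge (F i) u v ≡ false
  ⊆ᶜ-missing F C F⊆C i u v missing with edge (F i) u v in uv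
  ... | false = refl
  ... | true = trans (sym (F⊆C i u v uv)) missing

  deg-mono : ∀ C C′ u → C ⊆ᶜ C′ → deg C u ≤ deg C′ u
  deg-mono C C′ u C⊆C′ = ∑-mono-≤ (λ i → ∑-mono-≤ (λ y → χ-mono (C⊆C′ i u y)))

  insertAt : Config n m → Fin m → (u v : Fin n) → u ≢ v → Config n m
  insertAt C c u v u≢v i with i ≟ c
  ... | yes _ = insert (C i) u v u≢v
  ... | no _ = C i

  insertAt-at : ∀ C c u v u≢v → insertAt C c u v u≢v c ≡ insert (C c) u v u≢v
  insertAt-at C c u v u≢v with c ≟ c
  ... | yes _ = refl
  ... | no c≢c = ⊥-elim (c≢c refl)

  insertAt-other : ∀ C c u v u≢v i → i ≢ c → insertAt C c u v u≢v i ≡ C i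
  insertAt-other C c u v u≢v i i≢c with i ≟ c
  ... | yes i≡c = ⊥-elim (i≢c i≡c)
  ... | no _ = refl

  insertAt-arc : ∀ C c u v u≢v i x y → edge (insertAt C c u v u≢v i) x y ≡ true →
                 edge (C i) x y ≡ true ⊎ i ≡ c × (x ≡ u × y ≡ v ⊎ x ≡ v × y ≡ u)
  insertAt-arc C c u v u≢v i x y xy with i ≟ c
  ... | no _ = inj₁ xy
  ... | yes i≡c with insert-arc (C i) u v u≢v x y xy
  ...   | arc-uv x≡u y≡v = inj₂ (i≡c , inj₁ (x≡u , y≡v))
  ...   | arc-vu x≡v y≡u = inj₂ (i≡c , inj₂ (x≡v , y≡u))
  ...   | arc-old _ _ old = inj₁ old

  module _ (F : Config n m) (c : Fin m) {u v : Fin n} (u≢v : u ≢ v)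
           (u-free : mate (F c) u ≡ nothing) (v-free : mate (F c) v ≡ nothing) where

    cacheArcs-insertAt : cacheArcs F + 2 ≤ cacheArcs (insertAt F c u v u≢v)
    cacheArcs-insertAt = ∑-raiseAt _ _ c
      (λ i i≢c → cong arcs (sym (insertAt-other F c u v u≢v i i≢c)))
      (≤-trans (arcs-insert (F c) u≢v u-free v-free) (≤-reflexive (cong arcs (sym (insertAt-at F c u v u≢v)))))

    changeCost-insertAt : ∀ C → F ⊆ᶜ C → 2 * changeCost C (insertAt F c u v u≢v) ≤ 2
    changeCost-insertAt C F⊆C = begin
      2 * changeCost C N                     ≡⟨ twice-changeCost C N ⟩
      sum (λ i → newArcs (C i) (N i))        ≡⟨ ∑-pointAt _ c unchanged ⟩
      newArcs (C c) (N c)                    ≡⟨ cong (newArcs (C c)) (insertAt-at F c u v u≢v) ⟩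
      newArcs (C c) (insert (F c) u v u≢v)   ≤⟨ newArcs-insert (C c) (F c) u v u≢v (F⊆C c) ⟩
      2                                      ∎
      where
      open ≤-Reasoning
      N = insertAt F c u v u≢v
      unchanged : ∀ i → i ≢ c → newArcs (C i) (N i) ≡ 0
      unchanged i i≢c rewrite insertAt-other F c u v u≢v i i≢c = newArcs-⊆ (C i) (F i) (F⊆C i)

-- The algorithm

module Algorithm {n m : ℕ} (D : ℕ) (fallback : Fin m) where

  flushIfHeavy : Config n m → Fin n → Config n m
  flushIfHeavy C u with D ≤? deg C u
  ... | yes _ = C ∖ᶜ u
  ... | no _ = C

  free? : (F : Config n m) (u v : Fin n) → Dec (∃ λ i → mate (F i) u ≡ nothing × mate (F i) v ≡ nothing)
  free? F u v = any? (λ i → ≡-dec _≟_ (mate (F i) u) nothing ×-dec ≡-dec _≟_ (mate (F i) v) nothing)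

  -- The fallback is never used: after the flushes some matching is free at u and v (freeMatching-free).
  freeMatching : Config n m → Fin n → Fin n → Fin m
  freeMatching F u v with free? F u v
  ... | yes (i , _) = i
  ... | no _ = fallback

  serveMiss : Config n m → Request n → Config n m
  serveMiss C (req u v u≢v) = insertAt F (freeMatching F u v) u v u≢v
    where
    F = flushIfHeavy (flushIfHeavy C u) v

  serve : Config n m → Request n → Config n m
  serve C r with cached? C (src r) (dst r)
  ... | yes _ = C
  ... | no _ = serveMiss C r

  cacheAfter : List (Request n) → Config n m
  cacheAfter [] = emptyConfig
  cacheAfter (r ∷ h) = serve (cacheAfter h) r

  serve-serves : ∀ C r → r ∈C serve C r
  serve-serves C r with cached? C (src r) (dst r)
  ... | yes hit = hit
  ... | no _ = c , trans (cong (λ M → mate M (src r)) (insertAt-at F c (src r) (dst r) (distinct r)))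
                         (mate-+-u _ (src r) (dst r))
    where
    F = flushIfHeavy (flushIfHeavy C (src r)) (dst r)
    c = freeMatching F (src r) (dst r)

  algorithm : OnlineAlg n m
  algorithm = record { step = cacheAfter ; serves = λ r h → serve-serves (cacheAfter h) r }

  freeMatching-free : ∀ F u v → deg F u + deg F v < m →
                      mate (F (freeMatching F u v)) u ≡ nothing × mate (F (freeMatching F u v)) v ≡ nothing
  freeMatching-free F u v light with free? F u v
  ... | yes (_ , free) = free
  ... | no none = ⊥-elim (<⇒≱ light (begin
    m                                            ≡⟨ ∑-one m ⟨
    sum {m} (λ _ → 1)                            ≤⟨ ∑-mono-≤ busy ⟩
    sum (λ i → degree (F i) u + degree (F i) v)  ≡⟨ ∑-distrib-+ (λ i → degree (F i) u) (λ i → degree (F i) v) ⟩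
    deg F u + deg F v                            ∎))
    where
    open ≤-Reasoning
    busy : ∀ i → 1 ≤ degree (F i) u + degree (F i) v
    busy i = cases (mate (F i) u) refl (mate (F i) v) refl
      where
      cases : ∀ a → mate (F i) u ≡ a → ∀ b → mate (F i) v ≡ b → 1 ≤ degree (F i) u + degree (F i) v
      cases (just w) uw _ _ = ≤-trans (busy⇒degree≥1 (F i) u w uw) (m≤m+n _ (degree (F i) v))
      cases nothing _ (just w) vw = ≤-trans (busy⇒degree≥1 (F i) v w vw) (m≤n+m _ (degree (F i) u))
      cases nothing uw nothing vw = ⊥-elim (none (i , uw , vw))

-- Amortised analysis

-- 2 · cost + Φ₁ − Φ₀ ≤ 12 · opt for Φ = 6 · excess − arcs, stated without subtraction.
record Amortised (cost opt a₀ e₀ a₁ e₁ : ℕ) : Set where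
  constructor amortised
  field
    bound : 2 * cost + a₀ + 6 * e₁ ≤ a₁ + 12 * opt + 6 * e₀

amortised-trans : ∀ {c c′ o o′ a₀ a₁ a₂ e₀ e₁ e₂} →
                  Amortised c o a₀ e₀ a₁ e₁ → Amortised c′ o′ a₁ e₁ a₂ e₂ →
                  Amortised (c + c′) (o + o′) a₀ e₀ a₂ e₂
amortised-trans {c} {c′} {o} {o′} {a₀} {a₁} {a₂} {e₀} {e₁} {e₂} (amortised first) (amortised second) =
  amortised (+-cancelʳ-≤ (a₁ + 6 * e₁) _ _ (begin
    2 * (c + c′) + a₀ + 6 * e₂ + (a₁ + 6 * e₁)
      ≡⟨ regroup c c′ a₀ a₁ e₁ e₂ ⟩
    (2 * c + a₀ + 6 * e₁) + (2 * c′ + a₁ + 6 * e₂)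
      ≤⟨ +-mono-≤ first second ⟩
    (a₁ + 12 * o + 6 * e₀) + (a₂ + 12 * o′ + 6 * e₁)
      ≡⟨ regroup′ o o′ a₁ a₂ e₀ e₁ ⟩
    a₂ + 12 * (o + o′) + 6 * e₀ + (a₁ + 6 * e₁) ∎))
  where
  open ≤-Reasoning
  regroup : ∀ c c′ a₀ a₁ e₁ e₂ → 2 * (c + c′) + a₀ + 6 * e₂ + (a₁ + 6 * e₁) ≡
                                 (2 * c + a₀ + 6 * e₁) + (2 * c′ + a₁ + 6 * e₂)
  regroup = solve-∀
  regroup′ : ∀ o o′ a₁ a₂ e₀ e₁ → (a₁ + 12 * o + 6 * e₀) + (a₂ + 12 * o′ + 6 * e₁) ≡
                                  a₂ + 12 * (o + o′) + 6 * e₀ + (a₁ + 6 * e₁)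
  regroup′ = solve-∀

amortised-include : ∀ {o a e₀ e₁} → e₁ ≤ e₀ + 2 * o → Amortised 0 o a e₀ a e₁
amortised-include {o} {a} {e₀} {e₁} e₁≤ = amortised (begin
  a + 6 * e₁              ≤⟨ +-monoʳ-≤ a (*-monoʳ-≤ 6 e₁≤) ⟩
  a + 6 * (e₀ + 2 * o)    ≡⟨ regroup a e₀ o ⟩
  a + 12 * o + 6 * e₀     ∎)
  where
  open ≤-Reasoning
  regroup : ∀ a e₀ o → a + 6 * (e₀ + 2 * o) ≡ a + 12 * o + 6 * e₀
  regroup = solve-∀

amortised-flush : ∀ {Δ a₀ a₁ e₀ e₁} → a₀ ≤ a₁ + 2 * Δ → Δ + 3 * e₁ ≤ 3 * e₀ →
                  Amortised 0 0 a₀ e₀ a₁ e₁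
amortised-flush {Δ} {a₀} {a₁} {e₀} {e₁} arcs≤ paid = amortised (begin
  a₀ + 6 * e₁                 ≤⟨ +-monoˡ-≤ (6 * e₁) arcs≤ ⟩
  a₁ + 2 * Δ + 6 * e₁         ≡⟨ regroup a₁ Δ e₁ ⟩
  a₁ + 2 * (Δ + 3 * e₁)       ≤⟨ +-monoʳ-≤ a₁ (*-monoʳ-≤ 2 paid) ⟩
  a₁ + 2 * (3 * e₀)           ≡⟨ regroup′ a₁ e₀ ⟩
  a₁ + 12 * 0 + 6 * e₀        ∎)
  where
  open ≤-Reasoning
  regroup : ∀ a Δ e → a + 2 * Δ + 6 * e ≡ a + 2 * (Δ + 3 * e)
  regroup = solve-∀
  regroup′ : ∀ a e → a + 2 * (3 * e) ≡ a + 12 * 0 + 6 * e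
  regroup′ = solve-∀

amortised-insert : ∀ {c a₀ a₁ e} → 2 * c ≤ 2 → a₀ + 2 ≤ a₁ → Amortised c 0 a₀ e a₁ e
amortised-insert {c} {a₀} {a₁} {e} cost≤ arcs≤ = amortised (begin
  2 * c + a₀ + 6 * e          ≤⟨ +-monoˡ-≤ (6 * e) (+-monoˡ-≤ a₀ cost≤) ⟩
  2 + a₀ + 6 * e              ≡⟨ cong (_+ 6 * e) (+-comm 2 a₀) ⟩
  a₀ + 2 + 6 * e              ≤⟨ +-monoˡ-≤ (6 * e) arcs≤ ⟩
  a₁ + 6 * e                  ≡⟨ cong (_+ 6 * e) (+-identityʳ a₁) ⟨
  a₁ + 12 * 0 + 6 * e         ∎)
  where open ≤-Reasoning

amortised-end : ∀ {a e B} → a ≤ B → Amortised 0 0 a e B 0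
amortised-end {a} {e} {B} a≤B = amortised (begin
  a + 6 * 0                    ≡⟨ +-identityʳ a ⟩
  a                            ≤⟨ a≤B ⟩
  B                            ≤⟨ m≤m+n B (12 * 0) ⟩
  B + 12 * 0                   ≤⟨ m≤m+n _ (6 * e) ⟩
  B + 12 * 0 + 6 * e           ∎)
  where open ≤-Reasoning

amortised⇒competitive : ∀ {c o a B} → Amortised c o a 0 B 0 → c ≤ 6 * o + B
amortised⇒competitive {c} {o} {a} {B} (amortised bound) = *-cancelˡ-≤ 2 (begin
  2 * c                        ≤⟨ m≤m+n (2 * c) a ⟩
  2 * c + a                    ≡⟨ +-identityʳ _ ⟨
  2 * c + a + 6 * 0            ≤⟨ bound ⟩
  B + 12 * o + 6 * 0           ≤⟨ +-monoʳ-≤ (B + 12 * o) z≤n ⟩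
  B + 12 * o + B               ≡⟨ regroup B o ⟩
  2 * (6 * o + B)              ∎)
  where
  open ≤-Reasoning
  regroup : ∀ B o → B + 12 * o + B ≡ 2 * (6 * o + B)
  regroup = solve-∀

heavy-degree-bound : ∀ {D d Λ k} → D ≤ d → d + 1 ≤ Λ + k → 3 * k ≤ 2 * D + 3 → d ≤ 3 * Λ
heavy-degree-bound {D} {d} {Λ} {k} D≤d row≤ k≤ = +-cancelʳ-≤ (2 * d + 3) d (3 * Λ) (begin
  d + (2 * d + 3)          ≡⟨ regroup d ⟩
  3 * (d + 1)              ≤⟨ *-monoʳ-≤ 3 row≤ ⟩
  3 * (Λ + k)              ≡⟨ *-distribˡ-+ 3 Λ k ⟩
  3 * Λ + 3 * k            ≤⟨ +-monoʳ-≤ (3 * Λ) (≤-trans k≤ (+-monoˡ-≤ 3 (*-monoʳ-≤ 2 D≤d))) ⟩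
  3 * Λ + (2 * d + 3)      ∎)
  where
  open ≤-Reasoning
  regroup : ∀ d → d + (2 * d + 3) ≡ 3 * (d + 1)
  regroup = solve-∀

ArcSet : ℕ → Set
ArcSet n = Fin n → Fin n → Bool

module _ {n : ℕ} where

  excessRow : ArcSet n → ArcSet n → Fin n → ℕ
  excessRow recent snapshot u = sum (λ v → χ (recent u v ∧ not (snapshot u v)))

  excess : ArcSet n → ArcSet n → ℕ
  excess recent snapshot = sum (excessRow recent snapshot)

  resetRow : ArcSet n → ArcSet n → Fin n → ArcSet n
  resetRow A B u w with w ≟ u
  ... | yes _ = B u
  ... | no _ = A w

  resetRow-at : ∀ A B u → resetRow A B u u ≡ B u
  resetRow-at A B u with u ≟ u
  ... | yes _ = refl
  ... | no u≢u = ⊥-elim (u≢u refl)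

  resetRow-other : ∀ A B u w → w ≢ u → resetRow A B u w ≡ A w
  resetRow-other A B u w w≢u with w ≟ u
  ... | yes w≡u = ⊥-elim (w≢u w≡u)
  ... | no _ = refl

  excess-resetRow : ∀ recent snapshot B u →
    excess (resetRow recent B u) (resetRow snapshot B u) + excessRow recent snapshot u ≡ excess recent snapshot
  excess-resetRow recent snapshot B u = ∑-dropAt _ _ u
    (λ w w≢u → cong₂ (λ r s → sum (λ v → χ (r v ∧ not (s v))))
                     (sym (resetRow-other recent B u w w≢u)) (sym (resetRow-other snapshot B u w w≢u)))
    (trans (cong₂ (λ r s → sum (λ v → χ (r v ∧ not (s v)))) (resetRow-at recent B u) (resetRow-at snapshot B u))
           (∑-zero (λ v → cong χ (∧-inverseʳ (B u v)))))

  module _ {k : ℕ} where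

    include : ArcSet n → Config n k → ArcSet n
    include recent C′ x y = recent x y ∨ cached C′ x y

    excess-include : ∀ recent snapshot (C C′ : Config n k) →
                     (∀ i x y → edge (C i) x y ≡ true → recent x y ≡ true) →
                     excess (include recent C′) snapshot ≤ excess recent snapshot + 2 * changeCost C C′
    excess-include recent snapshot C C′ C⊆recent = begin
      excess (include recent C′) snapshot
        ≤⟨ ∑∑-mono-≤ pointwise ⟩
      ∑∑ (λ x y → χ (recent x y ∧ not (snapshot x y)) + sum (λ i → fresh i x y))
        ≡⟨ ∑∑-distrib-+ (λ x y → χ (recent x y ∧ not (snapshot x y))) _ ⟩
      excess recent snapshot + ∑∑ (λ x y → sum (λ i → fresh i x y))
        ≡⟨ cong (excess recent snapshot +_) (trans reorder (sym (twice-changeCost C C′))) ⟩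
      excess recent snapshot + 2 * changeCost C C′ ∎
      where
      open ≤-Reasoning
      fresh : Fin k → Fin n → Fin n → ℕ
      fresh i x y = χ (edge (C′ i) x y ∧ not (edge (C i) x y))
      reorder : ∑∑ (λ x y → sum (λ i → fresh i x y)) ≡ sum (λ i → newArcs (C i) (C′ i))
      reorder = trans (sum-cong-≗ (λ x → ∑-comm (λ y i → fresh i x y))) (∑-comm (λ x i → sum (fresh i x)))
      pointwise : ∀ x y → χ ((recent x y ∨ cached C′ x y) ∧ not (snapshot x y)) ≤
                          χ (recent x y ∧ not (snapshot x y)) + sum (λ i → fresh i x y)
      pointwise x y with recent x y in r
      ... | true = m≤m+n _ _
      ... | false with cached C′ x y in c
      ...   | false = z≤n
      ...   | true with cached-elim C′ x y c
      ...     | i , xy =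
        ≤-trans (χ≤1 _) (≤-trans (≤-reflexive (cong χ (sym isFresh))) (term≤∑ (λ i → fresh i x y) i))
        where
        isFresh : edge (C′ i) x y ∧ not (edge (C i) x y) ≡ true
        isFresh with edge (C i) x y in old
        ... | false = trans (∧-identityʳ _) xy
        ... | true with trans (sym r) (C⊆recent i x y old)
        ...   | ()

-- recent x y: the arc (x,y) has been cached by OPT since x was last flushed;
-- snapshot x: OPT's arcs at x at that flush.
record Invariant {n m k : ℕ} (C : Config n m) (recent snapshot : ArcSet n) (C′ : Config n k) : Set where
  field
    cache-unique  : ∀ i j x y → edge (C i) x y ≡ true → edge (C j) x y ≡ true → i ≡ j
    cache⊆recent  : ∀ i x y → edge (C i) x y ≡ true → recent x y ≡ true
    opt⊆recent    : ∀ i x y → edge (C′ i) x y ≡ true → recent x y ≡ true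
    snapshot-row≤ : ∀ x → sum (λ y → χ (snapshot x y)) ≤ k

module _ {n m k : ℕ} {C : Config n m} {recent snapshot : ArcSet n} {C′ : Config n k}
         (inv : Invariant C recent snapshot C′) where

  open Invariant inv

  cached⇒recent : ∀ x y → cached C′ x y ≡ true → recent x y ≡ true
  cached⇒recent x y xy = opt⊆recent _ x y (proj₂ (cached-elim C′ x y xy))

  deg<recentRow : ∀ u t → (∀ i → edge (C i) u t ≡ false) → recent u t ≡ true →
                  deg C u + 1 ≤ sum (λ v → χ (recent u v))
  deg<recentRow u t missing recent-ut = begin
    deg C u + 1
      ≡⟨ cong₂ _+_ (∑-comm (λ i v → χ (edge (C i) u v))) (sym (∑δ t)) ⟩
    sum (λ v → copies v) + sum (λ v → χ (δ v t))
      ≤⟨ +-monoˡ-≤ _ (∑-mono-≤ copies≤) ⟩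
    sum (λ v → χ (recent u v ∧ not (δ v t))) + sum (λ v → χ (δ v t))
      ≡⟨ ∑-distrib-+ (λ v → χ (recent u v ∧ not (δ v t))) (λ v → χ (δ v t)) ⟨
    sum (λ v → χ (recent u v ∧ not (δ v t)) + χ (δ v t))
      ≤⟨ ∑-mono-≤ merge ⟩
    sum (λ v → χ (recent u v)) ∎
    where
    open ≤-Reasoning
    copies : Fin n → ℕ
    copies v = sum (λ i → χ (edge (C i) u v))
    copies≤ : ∀ v → copies v ≤ χ (recent u v ∧ not (δ v t))
    copies≤ v with v ≟ t
    ... | yes refl = ≤-trans (≤-reflexive (∑-zero (λ i → cong χ (missing i)))) z≤n
    ... | no _ with recent u v in r
    ...   | true = ∑χ-unique (λ i → edge (C i) u v) (λ i j → cache-unique i j u v)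
    ...   | false = ≤-reflexive (∑-zero absent)
      where
      absent : ∀ i → χ (edge (C i) u v) ≡ 0
      absent i with edge (C i) u v in uv
      ... | false = refl
      ... | true with trans (sym r) (cache⊆recent i u v uv)
      ...   | ()
    merge : ∀ v → χ (recent u v ∧ not (δ v t)) + χ (δ v t) ≤ χ (recent u v)
    merge v with v ≟ t
    ... | yes refl rewrite recent-ut = ≤-refl
    ... | no _ rewrite ∧-identityʳ (recent u v) | +-identityʳ (χ (recent u v)) = ≤-refl

  recentRow≤ : ∀ u → sum (λ v → χ (recent u v)) ≤ excessRow recent snapshot u + k
  recentRow≤ u = begin
    sum (λ v → χ (recent u v))
      ≤⟨ ∑-mono-≤ (λ v → split (recent u v) (snapshot u v)) ⟩
    sum (λ v → χ (recent u v ∧ not (snapshot u v)) + χ (snapshot u v))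
      ≡⟨ ∑-distrib-+ (λ v → χ (recent u v ∧ not (snapshot u v))) (λ v → χ (snapshot u v)) ⟩
    excessRow recent snapshot u + sum (λ v → χ (snapshot u v))
      ≤⟨ +-monoʳ-≤ _ (snapshot-row≤ u) ⟩
    excessRow recent snapshot u + k ∎
    where
    open ≤-Reasoning
    split : ∀ r s → χ r ≤ χ (r ∧ not s) + χ s
    split true true = ≤-refl
    split true false = ≤-refl
    split false s = z≤n

  invariant-∖ᶜ : ∀ u → Invariant (C ∖ᶜ u) (resetRow recent (cached C′) u) (resetRow snapshot (cached C′) u) C′
  invariant-∖ᶜ u = record
    { cache-unique  = λ i j x y xy xy′ → cache-unique i j x y (∖-⊆ (C i) u x y xy) (∖-⊆ (C j) u x y xy′)
    ; cache⊆recent  = cache⊆reset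
    ; opt⊆recent    = opt⊆reset
    ; snapshot-row≤ = snapshot-row≤′ }
    where
    cache⊆reset : ∀ i x y → edge (C i ∖ u) x y ≡ true → resetRow recent (cached C′) u x y ≡ true
    cache⊆reset i x y xy = byCases (x ≟ u)
      where
      byCases : Dec (x ≡ u) → resetRow recent (cached C′) u x y ≡ true
      byCases (yes refl) with trans (sym xy) (∖-row (C i) x y)
      ... | ()
      byCases (no x≢u) = trans (cong (λ row → row y) (resetRow-other recent (cached C′) u x x≢u))
                               (cache⊆recent i x y (∖-⊆ (C i) u x y xy))
    opt⊆reset : ∀ i x y → edge (C′ i) x y ≡ true → resetRow recent (cached C′) u x y ≡ true
    opt⊆reset i x y xy = byCases (x ≟ u)
      where
      byCases : Dec (x ≡ u) → resetRow recent (cached C′) u x y ≡ true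
      byCases (yes refl) = trans (cong (λ row → row y) (resetRow-at recent (cached C′) x)) (cached-intro C′ x y i xy)
      byCases (no x≢u) = trans (cong (λ row → row y) (resetRow-other recent (cached C′) u x x≢u))
                               (opt⊆recent i x y xy)
    snapshot-row≤′ : ∀ x → sum (λ y → χ (resetRow snapshot (cached C′) u x y)) ≤ k
    snapshot-row≤′ x = byCases (x ≟ u)
      where
      row≤ : ∀ {row} → resetRow snapshot (cached C′) u x ≡ row → sum (λ y → χ (row y)) ≤ k →
             sum (λ y → χ (resetRow snapshot (cached C′) u x y)) ≤ k
      row≤ refl bound = bound
      byCases : Dec (x ≡ u) → sum (λ y → χ (resetRow snapshot (cached C′) u x y)) ≤ k
      byCases (yes refl) = row≤ (resetRow-at snapshot (cached C′) x) (cached-row≤ C′ x)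
      byCases (no x≢u) = row≤ (resetRow-other snapshot (cached C′) u x x≢u) (snapshot-row≤ x)

  invariant-include : (C″ : Config n k) → Invariant C (include recent C″) snapshot C″
  invariant-include C″ = record
    { cache-unique  = cache-unique
    ; cache⊆recent  = λ i x y xy → cong (_∨ cached C″ x y) (cache⊆recent i x y xy)
    ; opt⊆recent    = λ i x y xy → trans (cong (recent x y ∨_) (cached-intro C″ x y i xy)) (∨-zeroʳ (recent x y))
    ; snapshot-row≤ = snapshot-row≤ }

  invariant-insertAt : ∀ c {u v} (u≢v : u ≢ v) → (∀ i → edge (C i) u v ≡ false) → cached C′ u v ≡ true →
                       Invariant (insertAt C c u v u≢v) recent snapshot C′
  invariant-insertAt c {u} {v} u≢v missing wanted = record
    { cache-unique  = unique
    ; cache⊆recent  = ⊆recent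
    ; opt⊆recent    = opt⊆recent
    ; snapshot-row≤ = snapshot-row≤ }
    where
    N = insertAt C c u v u≢v
    notCached : ∀ i x y → edge (C i) x y ≡ true → x ≡ u × y ≡ v ⊎ x ≡ v × y ≡ u → ⊥
    notCached i x y xy (inj₁ (refl , refl)) with trans (sym xy) (missing i)
    ... | ()
    notCached i x y xy (inj₂ (refl , refl)) with trans (sym (trans (edge-sym (C i) u v) xy)) (missing i)
    ... | ()
    unique : ∀ i j x y → edge (N i) x y ≡ true → edge (N j) x y ≡ true → i ≡ j
    unique i j x y xy xy′ with insertAt-arc C c u v u≢v i x y xy | insertAt-arc C c u v u≢v j x y xy′
    ... | inj₁ old | inj₁ old′ = cache-unique i j x y old old′
    ... | inj₁ old | inj₂ (_ , new) = ⊥-elim (notCached i x y old new)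
    ... | inj₂ (_ , new) | inj₁ old′ = ⊥-elim (notCached j x y old′ new)
    ... | inj₂ (i≡c , _) | inj₂ (j≡c , _) = trans i≡c (sym j≡c)
    ⊆recent : ∀ i x y → edge (N i) x y ≡ true → recent x y ≡ true
    ⊆recent i x y xy with insertAt-arc C c u v u≢v i x y xy
    ... | inj₁ old = cache⊆recent i x y old
    ... | inj₂ (_ , inj₁ (refl , refl)) = cached⇒recent u v wanted
    ... | inj₂ (_ , inj₂ (refl , refl)) = cached⇒recent v u (cached-sym C′ u v wanted)

module Analysis {n m k : ℕ} (D : ℕ) (fallback : Fin m)
                (D≥1 : 1 ≤ D) (2D≤m+1 : 2 * D ≤ suc m) (3k≤2D+3 : 3 * k ≤ 2 * D + 3) where

  open Algorithm {n} {m} D fallback public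

  record Step (C : Config n m) (e : ℕ) (C′ : Config n k) (cost opt : ℕ) (N : Config n m) : Set where
    constructor mkStep
    field
      recent snapshot : ArcSet n
      invariant       : Invariant N recent snapshot C′
      bound           : Amortised cost opt (cacheArcs C) e (cacheArcs N) (excess recent snapshot)

  private variable
    C F : Config n m
    Cp C′ : Config n k
    recent snapshot : ArcSet n

  step-trans : ∀ {N e c c′ o o′} → Step C e C′ c o F →
               (∀ {recent snapshot} → Invariant F recent snapshot C′ →
                                      Step F (excess recent snapshot) C′ c′ o′ N) →
               Step C e C′ (c + c′) (o + o′) N
  step-trans (mkStep _ _ inv now) later with later inv
  ... | mkStep recent snapshot inv′ next = mkStep recent snapshot inv′ (amortised-trans now next)

  include-step : (C′ : Config n k) → Invariant C recent snapshot Cp →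
                 Step C (excess recent snapshot) C′ 0 (changeCost Cp C′) C
  include-step {recent = recent} {snapshot = snapshot} {Cp = Cp} C′ inv =
    mkStep (include recent C′) snapshot (invariant-include inv C′) $
    amortised-include (excess-include recent snapshot Cp C′ (Invariant.opt⊆recent inv))

  flush-step : ∀ u t → Invariant C recent snapshot C′ →
               (∀ i → edge (C i) u t ≡ false) → cached C′ u t ≡ true → D ≤ deg C u →
               Step C (excess recent snapshot) C′ 0 0 (C ∖ᶜ u)
  flush-step {C = C} {recent = recent} {snapshot = snapshot} {C′ = C′} u t inv missing wanted heavy =
    mkStep (reset recent) (reset snapshot) (invariant-∖ᶜ inv u) $
    amortised-flush {Δ = deg C u} (cacheArcs-∖ᶜ C u) paid
    where
    reset : ArcSet n → ArcSet n
    reset A = resetRow A (cached C′) u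
    Λ : ℕ
    Λ = excessRow recent snapshot u
    deg≤3Λ : deg C u ≤ 3 * Λ
    deg≤3Λ = heavy-degree-bound {Λ = Λ} {k = k} heavy
      (≤-trans (deg<recentRow inv u t missing (cached⇒recent inv u t wanted)) (recentRow≤ inv u)) 3k≤2D+3
    paid : deg C u + 3 * excess (reset recent) (reset snapshot) ≤ 3 * excess recent snapshot
    paid = begin
      deg C u + 3 * excess (reset recent) (reset snapshot)   ≤⟨ +-monoˡ-≤ _ deg≤3Λ ⟩
      3 * Λ + 3 * excess (reset recent) (reset snapshot)     ≡⟨ *-distribˡ-+ 3 Λ _ ⟨
      3 * (Λ + excess (reset recent) (reset snapshot))
        ≡⟨ cong (3 *_) (trans (+-comm Λ _) (excess-resetRow recent snapshot (cached C′) u)) ⟩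
      3 * excess recent snapshot                             ∎
      where open ≤-Reasoning

  flushIfHeavy-step : ∀ u t → Invariant C recent snapshot C′ →
                      (∀ i → edge (C i) u t ≡ false) → cached C′ u t ≡ true →
                      Step C (excess recent snapshot) C′ 0 0 (flushIfHeavy C u)
  flushIfHeavy-step {C = C} {recent = recent} {snapshot = snapshot} u t inv missing wanted
    with D ≤? deg C u
  ... | yes heavy = flush-step u t inv missing wanted heavy
  ... | no _ = mkStep recent snapshot inv (amortised-include (m≤m+n _ 0))

  flushIfHeavy-⊆ : ∀ C u → flushIfHeavy C u ⊆ᶜ C
  flushIfHeavy-⊆ C u with D ≤? deg C u
  ... | yes _ = ∖ᶜ-⊆ C u
  ... | no _ = λ _ _ _ xy → xy

  flushIfHeavy-light : ∀ C u → deg (flushIfHeavy C u) u < D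
  flushIfHeavy-light C u with D ≤? deg C u
  ... | yes _ = ≤-trans (s≤s (≤-reflexive (deg-∖ᶜ C u))) D≥1
  ... | no light = ≰⇒> light

  light-pair : ∀ {a b} → a < D → b < D → a + b < m
  light-pair {a} {b} a<D b<D = +-cancelˡ-< 1 (a + b) m (begin-strict
    suc (a + b)     <⟨ s≤s (+-monoʳ-< a b<D) ⟩
    suc (a + D)     ≤⟨ +-monoˡ-≤ D a<D ⟩
    D + D           ≡⟨ cong (D +_) (+-identityʳ D) ⟨
    2 * D           ≤⟨ 2D≤m+1 ⟩
    suc m           ∎)
    where open ≤-Reasoning

  insert-step : ∀ c {u v} (u≢v : u ≢ v) → Invariant F recent snapshot C′ → F ⊆ᶜ C →
                (∀ i → edge (C i) u v ≡ false) → cached C′ u v ≡ true →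
                mate (F c) u ≡ nothing → mate (F c) v ≡ nothing →
                Step F (excess recent snapshot) C′ (changeCost C (insertAt F c u v u≢v)) 0 (insertAt F c u v u≢v)
  insert-step {F = F} {recent = recent} {snapshot = snapshot} {C = C} c u≢v inv F⊆C missing wanted u-free v-free =
    mkStep recent snapshot
      (invariant-insertAt inv c u≢v (λ i → ⊆ᶜ-missing F C F⊆C i _ _ (missing i)) wanted) $
    amortised-insert (changeCost-insertAt F c u≢v u-free v-free C F⊆C) (cacheArcs-insertAt F c u≢v u-free v-free)

  miss-step : ∀ r → Invariant C recent snapshot Cp → r ∈C C′ → ¬ r ∈C C →
              Step C (excess recent snapshot) C′ (changeCost C (serveMiss C r)) (changeCost Cp C′) (serveMiss C r)
  miss-step {C = C} {recent = recent} {snapshot = snapshot} {C′ = C′} (req u v u≢v) inv (j , wanted-uv) notCached =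
    subst (λ opt → Step C (excess recent snapshot) C′ (changeCost C N) opt N) (+-identityʳ _)
      (step-trans (include-step C′ inv) λ inv₀ →
       step-trans (flushIfHeavy-step u v inv₀ missing wanted) λ inv₁ →
       step-trans (flushIfHeavy-step v u inv₁ missing₁ (cached-sym C′ u v wanted)) λ inv₂ →
       insert-step c u≢v inv₂ F₂⊆C missing wanted (proj₁ free) (proj₂ free))
    where
    F₁ = flushIfHeavy C u
    F₂ = flushIfHeavy F₁ v
    c = freeMatching F₂ u v
    N = insertAt F₂ c u v u≢v
    wanted : cached C′ u v ≡ true
    wanted = cached-intro C′ u v j (mate⇒edge (C′ j) u v wanted-uv)
    missing : ∀ i → edge (C i) u v ≡ false
    missing i with edge (C i) u v in uv
    ... | false = refl
    ... | true = ⊥-elim (notCached (i , edge⇒mate (C i) u v uv))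
    missing₁ : ∀ i → edge (F₁ i) v u ≡ false
    missing₁ i = ⊆ᶜ-missing F₁ C (flushIfHeavy-⊆ C u) i v u (trans (edge-sym (C i) v u) (missing i))
    F₂⊆C : F₂ ⊆ᶜ C
    F₂⊆C i x y = flushIfHeavy-⊆ C u i x y ∘ flushIfHeavy-⊆ F₁ v i x y
    free : mate (F₂ c) u ≡ nothing × mate (F₂ c) v ≡ nothing
    free = freeMatching-free F₂ u v (light-pair
      (≤-<-trans (deg-mono F₂ F₁ u (flushIfHeavy-⊆ F₁ v)) (flushIfHeavy-light C u))
      (flushIfHeavy-light F₁ v))

  serve-step : ∀ r → Invariant C recent snapshot Cp → r ∈C C′ →
               Step C (excess recent snapshot) C′ (changeCost C (serve C r)) (changeCost Cp C′) (serve C r)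
  serve-step {C = C} {recent = recent} {snapshot = snapshot} {Cp = Cp} {C′ = C′} r inv wanted
    with cached? C (src r) (dst r)
  ... | yes _ = subst (λ cost → Step C (excess recent snapshot) C′ cost (changeCost Cp C′) C)
                      (sym (changeCost-⊆ C C (λ _ _ _ xy → xy))) (include-step C′ inv)
  ... | no notCached = miss-step r inv wanted notCached

  maxArcs : ℕ
  maxArcs = sum {m} (λ _ → ∑∑ {n} {n} (λ _ _ → 1))

  cacheArcs≤maxArcs : ∀ (C : Config n m) → cacheArcs C ≤ maxArcs
  cacheArcs≤maxArcs C = ∑-mono-≤ (λ i → ∑∑-mono-≤ (λ x y → χ≤1 (edge (C i) x y)))

  amortised-run : ∀ h σ (S : List (Config n k)) Cp recent snapshot →
                  Invariant (cacheAfter h) recent snapshot Cp → Feasible σ S →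
                  Amortised (onlineCostFrom algorithm (cacheAfter h) h σ) (scheduleCostFrom Cp S)
                            (cacheArcs (cacheAfter h)) (excess recent snapshot) maxArcs 0
  amortised-run h [] [] Cp recent snapshot inv [] =
    amortised-end {e = excess recent snapshot} (cacheArcs≤maxArcs (cacheAfter h))
  amortised-run h (r ∷ σ) (C′ ∷ S) Cp recent snapshot inv (wanted ∷ feasible) =
    let mkStep recent′ snapshot′ inv′ now = serve-step r inv wanted
    in amortised-trans now (amortised-run (r ∷ h) σ S C′ recent′ snapshot′ inv′ feasible)

  competitive : Competitive 6 k algorithm
  competitive = maxArcs , λ σ S feasible → amortised⇒competitive
    (subst (λ e → Amortised (onlineCost algorithm σ) (scheduleCost S) (cacheArcs {n} {m} emptyConfig) e maxArcs 0)
           (∑-zero {n} (λ _ → ∑-zero {n} (λ _ → refl)))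
           (amortised-run [] σ S (emptyConfig {n} {k}) never never initial feasible))
    where
    never : ArcSet n
    never _ _ = false
    initial : Invariant (emptyConfig {n} {m}) never never (emptyConfig {n} {k})
    initial = record
      { cache-unique  = λ _ _ _ _ ()
      ; cache⊆recent  = λ _ _ _ ()
      ; opt⊆recent    = λ _ _ _ ()
      ; snapshot-row≤ = λ _ → ≤-trans (≤-reflexive (∑-zero {n} (λ _ → refl))) z≤n }

⌈n/2⌉-positive : ∀ {n} → 0 < n → 0 < ⌈ n /2⌉
⌈n/2⌉-positive {suc n} _ = s≤s z≤n

⌈n/2⌉-bounds : ∀ n → n ≤ 2 * ⌈ n /2⌉ × 2 * ⌈ n /2⌉ ≤ suc n
⌈n/2⌉-bounds zero = z≤n , z≤n
⌈n/2⌉-bounds (suc zero) = s≤s z≤n , ≤-refl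
⌈n/2⌉-bounds (suc (suc n)) rewrite *-suc 2 ⌈ n /2⌉ with ⌈n/2⌉-bounds n
... | lower , upper = s≤s (s≤s lower) , s≤s (s≤s upper)

3k∸3-positive : ∀ {k} → 2 ≤ k → 0 < 3 * k ∸ 3
3k∸3-positive {k} 2≤k = ≤-trans (s≤s z≤n) (∸-monoˡ-≤ 3 (*-monoʳ-≤ 3 2≤k))

3k≡3k∸3+3 : ∀ {k} → 1 ≤ k → 3 * k ≡ 3 * k ∸ 3 + 3
3k≡3k∸3+3 {k} 1≤k = sym (m∸n+n≡m (*-monoʳ-≤ 3 1≤k))

corollary28 : (k : ℕ) → 2 ≤ k → (n : ℕ) →
    Σ (OnlineAlg n (3 * k ∸ 3)) λ A → Competitive 6 k A
corollary28 k 2≤k n = algorithm , competitive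
  where
  m = 3 * k ∸ 3
  -- Small enough for 2D ≤ m + 1, large enough for 3k ≤ 2D + 3.
  D = ⌈ m /2⌉
  m>0 : 0 < m
  m>0 = 3k∸3-positive 2≤k
  3k≤2D+3 : 3 * k ≤ 2 * D + 3
  3k≤2D+3 = ≤-trans (≤-reflexive (3k≡3k∸3+3 (≤-trans (s≤s z≤n) 2≤k)))
                    (+-monoˡ-≤ 3 (proj₁ (⌈n/2⌉-bounds m)))
  open Analysis {n} {m} {k} D (fromℕ< m>0) (⌈n/2⌉-positive m>0) (proj₂ (⌈n/2⌉-bounds m)) 3k≤2D+3
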